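{- Let $a_1,b_1>0$ and $a_2,b_2\ge0$. Let $[\mathcal{D}_{n,k}]_{n,k\ge0}$ be defined by $\mathcal{D}_{0,0}=1$, $\mathcal{D}_{n,k}=0$ unless $0\le k\le n$, and for $n\ge1$ $$\mathcal{D}_{n,k}=(a_1k+a_2)\mathcal{D}_{n-1,k}+(b_1n-b_1k+b_2)\mathcal{D}_{n-1,k-1},$$ with $\mathcal{D}_n(q)=\sum_k\mathcal{D}_{n,k}q^k$. Then there exists an array $[\mathcal{F}_{n,k}]_{n,k\ge0}$ with $\mathcal{F}_{0,0}=1$, $\mathcal{F}_{n,k}=0$ unless $0\le k\le n$, satisfying for $n\ge1$ $$\mathcal{F}_{n,k}=(a_1k+a_2)\mathcal{F}_{n-1,k}+\Big(b_1k+b_2-b_1+\frac{a_2}{a_1}b_1\Big)\mathcal{F}_{n-1,k-1},$$ such that, with $\mathcal{F}_n(q)=\sum_k\mathcal{F}_{n,k}q^k$, $$\mathcal{D}_n(q)=\Big(1-\frac{b_1}{a_1}q\Big)^n\mathcal{F}_n\!\left(\frac{q}{1-\frac{b_1}{a_1}q}\right).$$ In addition, $$\mathcal{D}_{n,k}=\sum_{i\ge0}\mathcal{F}_{n,i}\binom{n-i}{k-i}\Big(-\frac{b_1}{a_1}\Big)^{k-i},\qquad \mathcal{F}_{n,i}=\sum_{j\ge0}\binom{\frac{a_2}{a_1}+\frac{b_2}{b_1}-1+i}{i}\binom{i}{j}\Big(\frac{b_1}{a_1}\Big)^i(-1)^{i-j}(a_2+a_1j)^n.$$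
   Context: For real $r$ and integer $k\ge0$, $\binom{r}{k}=r(r-1)\cdots(r-k+1)/k!$ (and $\binom{r}{k}=0$ for negative integers $k$); also $0^0=1$. -}

module Defs where

open import Level using (Level; _⊔_) renaming (suc to lsuc)
open import Algebra.Bundles using (CommutativeRing)
open import Relation.Binary.Core using (Rel)
open import Relation.Binary.Structures using (IsStrictTotalOrder)
open import Relation.Nullary using (¬_)
open import Data.Nat as ℕ using (ℕ; zero; suc; _∸_; _!)
open import Data.Nat.Combinatorics using (_C_)
open import Data.Sum using (_⊎_)
open import Data.Product using (_×_)
open import Data.Bool using (true; false)

-- The inverse is a
-- total operation whose defining law is only required for nonzero elements
-- (the value 0⁻¹ is irrelevant; for ℝ take 0⁻¹ = 0).
record OrderedField (c ℓ₁ ℓ₂ : Level) : Set (lsuc (c ⊔ ℓ₁ ⊔ ℓ₂)) where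
  field
    commutativeRing : CommutativeRing c ℓ₁
  open CommutativeRing commutativeRing public
  infix 4 _<_
  infix 8 _⁻¹
  field
    _<_                : Rel Carrier ℓ₂
    isStrictTotalOrder : IsStrictTotalOrder _≈_ _<_
    0≉1                : ¬ (0# ≈ 1#)
    +-mono-<           : ∀ {x y} z → x < y → x + z < y + z
    *-pos              : ∀ {x y} → 0# < x → 0# < y → 0# < x * y
    _⁻¹                : Carrier → Carrier
    ⁻¹-cong            : ∀ {x y} → x ≈ y → x ⁻¹ ≈ y ⁻¹
    ⁻¹-inverse         : ∀ x → ¬ (x ≈ 0#) → x * x ⁻¹ ≈ 1#

module OF {c ℓ₁ ℓ₂} (K : OrderedField c ℓ₁ ℓ₂) where
  open OrderedField K hiding (zero)

  infix 4 _≤_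
  _≤_ : Rel Carrier (ℓ₁ ⊔ ℓ₂)
  x ≤ y = x < y ⊎ x ≈ y

  infixl 7 _/_
  _/_ : Carrier → Carrier → Carrier
  x / y = x * y ⁻¹

  ι : ℕ → Carrier
  ι zero    = 0#
  ι (suc n) = 1# + ι n

  infixr 8 _^_
  _^_ : Carrier → ℕ → Carrier
  x ^ zero  = 1#
  x ^ suc n = x * x ^ n

  sumTo : ℕ → (ℕ → Carrier) → Carrier
  sumTo zero    f = f 0
  sumTo (suc n) f = sumTo n f + f (suc n)

  falling : Carrier → ℕ → Carrier
  falling r zero    = 1#
  falling r (suc k) = falling r k * (r - ι k)

  binomR : Carrier → ℕ → Carrier
  binomR r k = falling r k / ι (k !)

  -- value at (n , k-1), where index -1 gives 0
  prev : (ℕ → ℕ → Carrier) → ℕ → ℕ → Carrier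
  prev T n zero    = 0#
  prev T n (suc k) = T n k

  record TriangularRec (α β : ℕ → ℕ → Carrier) (T : ℕ → ℕ → Carrier)
         : Set ℓ₁ where
    field
      init  : T 0 0 ≈ 1#
      zeros : ∀ n k → n ℕ.< k → T n k ≈ 0#
      rec   : ∀ n k → T (suc n) k ≈ α (suc n) k * T n k + β (suc n) k * prev T n k

  module _ (a₁ a₂ b₁ b₂ : Carrier) where

    αD βD : ℕ → ℕ → Carrier
    αD n k = a₁ * ι k + a₂
    βD n k = b₁ * ι n - b₁ * ι k + b₂

    D : ℕ → ℕ → Carrier
    D zero    zero    = 1#
    D zero    (suc k) = 0#
    D (suc n) zero    = αD (suc n) zero * D n zero
    D (suc n) (suc k) = αD (suc n) (suc k) * D n (suc k)
                        + βD (suc n) (suc k) * D n k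

    αF βF : ℕ → ℕ → Carrier
    αF n k = a₁ * ι k + a₂
    βF n k = b₁ * ι k + b₂ - b₁ + (a₂ / a₁) * b₁

    Dpoly : ℕ → Carrier → Carrier
    Dpoly n q = sumTo n (λ k → D n k * q ^ k)

  poly : (ℕ → ℕ → Carrier) → ℕ → Carrier → Carrier
  poly T n q = sumTo n (λ k → T n k * q ^ k)

  -- binom(n-i, k-i) * x^(k-i), with the convention binom(_, negative) = 0
  binomShift : ℕ → ℕ → ℕ → Carrier → Carrier
  binomShift n i k x with i ℕ.≤ᵇ k
  ... | true  = ι ((n ∸ i) C (k ∸ i)) * x ^ (k ∸ i)
  ... | false = 0#

module Submission where

-- Write c = b₁ / a₁.  The kernel binom(n - i, k - i) (- c)^(k - i) intertwines the
-- recurrences of F and D: after Pascal's rule the required identity reduces to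
-- a₁ c = b₁ and the absorption identity (l + 1) binom(m, l + 1) = (m - l) binom(m, l).
-- Hence Σᵢ F n i binom(n - i, k - i) (- c)^(k - i) satisfies the recurrence of D and
-- equals D n k; summing against q^k with the binomial theorem gives the generating
-- function.  For the closed form, put r = a₂/a₁ + b₂/b₁ - 1 and p t = a₂ + a₁ t.  Then
-- binom(r + i, i) c^i (Δ^i pⁿ)(0) satisfies the recurrence of F, by the Leibniz rule
--   Δ^(i+1) (p g) (t) = p (i + 1 + t) Δ^(i+1) g (t) + a₁ (i + 1) Δ^i g (t),
-- and expanding Δ^i gives the stated sum.

open import Defs
open import Data.Nat using (ℕ; _∸_)
open import Data.Nat.Combinatorics using (_C_)
open import Data.Product using (Σ; _×_)
open import Relation.Nullary using (¬_)

open import Algebra.Bundles using (CommutativeRing)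
import Algebra.Properties.CommutativeSemigroup as CommutativeSemigroupProperties
import Algebra.Properties.Ring as RingProperties
import Algebra.Solver.Ring
import Algebra.Solver.Ring.AlmostCommutativeRing as ACR
open import Data.Bool using (true; false)
open import Data.Integer as ℤ using (ℤ; +_; -[1+_])
import Data.Integer.Properties as ℤ
open import Data.Maybe using (Maybe; just; nothing)
open import Data.Nat as ℕ using (zero; suc; z≤n; s≤s)
open import Data.Nat.Combinatorics using (nC1≡n; nCk+nC[k+1]≡[n+1]C[k+1])
open import Data.Nat.Combinatorics.Specification using (k>n⇒nCk≡0)
import Data.Nat.Properties as ℕ
open import Data.Product using (_,_)
open import Data.Sign as Sign using (Sign)
open import Data.Unit using (tt)
open import Relation.Binary.Definitions using (tri<; tri≈; tri>)
import Relation.Binary.PropositionalEquality as ≡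
open import Relation.Binary.Structures using (IsStrictTotalOrder)
open import Relation.Nullary using (yes; no; contradiction)

-- The ring solver with integer coefficients, so that normal forms cancel.  Integers are
-- interpreted through the optimised multiplication _×′_, for which ⟦ + 0 ⟧ and ⟦ + 1 ⟧
-- are 0# and 1# definitionally; hence con (+ 0) and con (+ 1) match 0# and 1# in goals.
module IntegerCoefficients {c ℓ} (R : CommutativeRing c ℓ) where
  open CommutativeRing R
  open RingProperties ring using (-0#≈0#; -1*x≈-x; -‿involutive; -‿+-comm)
  open CommutativeSemigroupProperties +-commutativeSemigroup using () renaming (interchange to +-interchange)
  open CommutativeSemigroupProperties *-commutativeSemigroup using () renaming (interchange to *-interchange)
  open import Algebra.Properties.Semiring.Mult.TCOptimised semiring
    using (×-homo-+; ×1-homo-*; 1+×) renaming (_×_ to _×′_)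
  open import Relation.Binary.Reasoning.Setoid setoid

  ⟦_⟧ : ℤ → Carrier
  ⟦ + n ⟧      = n ×′ 1#
  ⟦ -[1+ n ] ⟧ = - (suc n ×′ 1#)

  [1+x]-[1+y]≈x-y : ∀ x y → (1# + x) - (1# + y) ≈ x - y
  [1+x]-[1+y]≈x-y x y = begin
    (1# + x) - (1# + y)        ≈⟨ +-congˡ (-‿+-comm 1# y) ⟨
    (1# + x) + (- 1# + - y)    ≈⟨ +-interchange 1# x (- 1#) (- y) ⟩
    (1# - 1#) + (x - y)        ≈⟨ +-congʳ (-‿inverseʳ 1#) ⟩
    0# + (x - y)               ≈⟨ +-identityˡ _ ⟩
    x - y                      ∎

  ⟦⊖⟧ : ∀ m n → ⟦ m ℤ.⊖ n ⟧ ≈ m ×′ 1# - n ×′ 1#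
  ⟦⊖⟧ zero    zero    = sym (-‿inverseʳ 0#)
  ⟦⊖⟧ zero    (suc n) = sym (+-identityˡ _)
  ⟦⊖⟧ (suc m) zero    = sym (trans (+-congˡ -0#≈0#) (+-identityʳ _))
  ⟦⊖⟧ (suc m) (suc n) = begin
    ⟦ suc m ℤ.⊖ suc n ⟧               ≡⟨ ≡.cong ⟦_⟧ (ℤ.[1+m]⊖[1+n]≡m⊖n m n) ⟩
    ⟦ m ℤ.⊖ n ⟧                       ≈⟨ ⟦⊖⟧ m n ⟩
    m ×′ 1# - n ×′ 1#                 ≈⟨ [1+x]-[1+y]≈x-y (m ×′ 1#) (n ×′ 1#) ⟨
    (1# + m ×′ 1#) - (1# + n ×′ 1#)   ≈⟨ +-cong (1+× m 1#) (-‿cong (1+× n 1#)) ⟨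
    suc m ×′ 1# - suc n ×′ 1#         ∎

  ⟦_⟧ₛ : Sign → Carrier
  ⟦ Sign.+ ⟧ₛ = 1#
  ⟦ Sign.- ⟧ₛ = - 1#

  ⟦⟧ₛ-homo-* : ∀ s t → ⟦ s Sign.* t ⟧ₛ ≈ ⟦ s ⟧ₛ * ⟦ t ⟧ₛ
  ⟦⟧ₛ-homo-* Sign.+ t      = sym (*-identityˡ _)
  ⟦⟧ₛ-homo-* Sign.- Sign.+ = sym (*-identityʳ _)
  ⟦⟧ₛ-homo-* Sign.- Sign.- = sym (trans (-1*x≈-x (- 1#)) (-‿involutive 1#))

  ⟦◃⟧ : ∀ s n → ⟦ s ℤ.◃ n ⟧ ≈ ⟦ s ⟧ₛ * n ×′ 1#
  ⟦◃⟧ s      zero    = sym (zeroʳ _)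
  ⟦◃⟧ Sign.+ (suc n) = sym (*-identityˡ _)
  ⟦◃⟧ Sign.- (suc n) = sym (-1*x≈-x _)

  ⟦⟧-homo-* : ∀ i j → ⟦ i ℤ.* j ⟧ ≈ ⟦ i ⟧ * ⟦ j ⟧
  ⟦⟧-homo-* i j = begin
    ⟦ (ℤ.sign i Sign.* ℤ.sign j) ℤ.◃ (ℤ.∣ i ∣ ℕ.* ℤ.∣ j ∣) ⟧
      ≈⟨ ⟦◃⟧ _ (ℤ.∣ i ∣ ℕ.* ℤ.∣ j ∣) ⟩
    ⟦ ℤ.sign i Sign.* ℤ.sign j ⟧ₛ * (ℤ.∣ i ∣ ℕ.* ℤ.∣ j ∣) ×′ 1#
      ≈⟨ *-cong (⟦⟧ₛ-homo-* (ℤ.sign i) (ℤ.sign j)) (×1-homo-* ℤ.∣ i ∣ ℤ.∣ j ∣) ⟩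
    (⟦ ℤ.sign i ⟧ₛ * ⟦ ℤ.sign j ⟧ₛ) * (ℤ.∣ i ∣ ×′ 1# * ℤ.∣ j ∣ ×′ 1#)
      ≈⟨ *-interchange _ _ _ _ ⟩
    (⟦ ℤ.sign i ⟧ₛ * ℤ.∣ i ∣ ×′ 1#) * (⟦ ℤ.sign j ⟧ₛ * ℤ.∣ j ∣ ×′ 1#)
      ≈⟨ *-cong (sign◃abs i) (sign◃abs j) ⟩
    ⟦ i ⟧ * ⟦ j ⟧ ∎
    where
    sign◃abs : ∀ i → ⟦ ℤ.sign i ⟧ₛ * ℤ.∣ i ∣ ×′ 1# ≈ ⟦ i ⟧
    sign◃abs i = trans (sym (⟦◃⟧ (ℤ.sign i) ℤ.∣ i ∣)) (reflexive (≡.cong ⟦_⟧ (ℤ.◃-inverse i)))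

  ⟦⟧-homo-+ : ∀ i j → ⟦ i ℤ.+ j ⟧ ≈ ⟦ i ⟧ + ⟦ j ⟧
  ⟦⟧-homo-+ -[1+ m ] -[1+ n ] = begin
    - (suc (suc (m ℕ.+ n)) ×′ 1#)        ≡⟨ ≡.cong (λ k → - (suc k ×′ 1#)) (ℕ.+-suc m n) ⟨
    - ((suc m ℕ.+ suc n) ×′ 1#)          ≈⟨ -‿cong (×-homo-+ 1# (suc m) (suc n)) ⟩
    - (suc m ×′ 1# + suc n ×′ 1#)         ≈⟨ -‿+-comm _ _ ⟨
    - (suc m ×′ 1#) + - (suc n ×′ 1#)     ∎
  ⟦⟧-homo-+ -[1+ m ] (+ n)    = trans (⟦⊖⟧ n (suc m)) (+-comm _ _)
  ⟦⟧-homo-+ (+ m)    -[1+ n ] = ⟦⊖⟧ m (suc n)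
  ⟦⟧-homo-+ (+ m)    (+ n)    = ×-homo-+ 1# m n

  ⟦⟧-homo-neg : ∀ i → ⟦ ℤ.- i ⟧ ≈ - ⟦ i ⟧
  ⟦⟧-homo-neg (+ zero)  = sym -0#≈0#
  ⟦⟧-homo-neg (+ suc n) = refl
  ⟦⟧-homo-neg -[1+ n ]  = sym (-‿involutive _)

  homomorphism : ℤ.+-*-rawRing ACR.-Raw-AlmostCommutative⟶ ACR.fromCommutativeRing R
  homomorphism = record
    { ⟦_⟧ = ⟦_⟧ ; +-homo = ⟦⟧-homo-+ ; *-homo = ⟦⟧-homo-* ; -‿homo = ⟦⟧-homo-neg
    ; 0-homo = refl ; 1-homo = refl }

  _≟⟦⟧_ : ∀ i j → Maybe (⟦ i ⟧ ≈ ⟦ j ⟧)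
  i ≟⟦⟧ j with i ℤ.≟ j
  ... | yes ≡.refl = just refl
  ... | no _       = nothing

  open Algebra.Solver.Ring ℤ.+-*-rawRing (ACR.fromCommutativeRing R) homomorphism _≟⟦⟧_
    public using (solve; _:=_; _:+_; _:*_; :-_; _:-_; con)

[1+k]*nC[1+k]+k*nCk≡n*nCk : ∀ n k → suc k ℕ.* (n C suc k) ℕ.+ k ℕ.* (n C k) ≡.≡ n ℕ.* (n C k)
[1+k]*nC[1+k]+k*nCk≡n*nCk zero    zero    = ≡.refl
[1+k]*nC[1+k]+k*nCk≡n*nCk zero    (suc k) = ≡.cong₂ ℕ._+_ (ℕ.*-zeroʳ (suc (suc k))) (ℕ.*-zeroʳ (suc k))
[1+k]*nC[1+k]+k*nCk≡n*nCk (suc n) zero    = begin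
  1 ℕ.* (suc n C 1) ℕ.+ 0   ≡⟨ ℕ.+-identityʳ _ ⟩
  1 ℕ.* (suc n C 1)         ≡⟨ ℕ.*-identityˡ _ ⟩
  suc n C 1                 ≡⟨ nCk+nC[k+1]≡[n+1]C[k+1] n 0 ⟨
  suc (n C 1)               ≡⟨ ≡.cong suc (nC1≡n n) ⟩
  suc n                     ≡⟨ ℕ.*-identityʳ (suc n) ⟨
  suc n ℕ.* 1               ∎
  where open ≡.≡-Reasoning
[1+k]*nC[1+k]+k*nCk≡n*nCk (suc n) (suc k) = begin
  suc (suc k) ℕ.* (suc n C suc (suc k)) ℕ.+ suc k ℕ.* (suc n C suc k)
    ≡⟨ ≡.cong₂ (λ u v → suc (suc k) ℕ.* u ℕ.+ suc k ℕ.* v) (pascal (suc k)) (pascal k) ⟩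
  suc (suc k) ℕ.* (Y ℕ.+ Z) ℕ.+ suc k ℕ.* (X ℕ.+ Y)
    ≡⟨ solve 4 (λ k X Y Z → (con 2 :+ k) :* (Y :+ Z) :+ (con 1 :+ k) :* (X :+ Y)
                := ((con 2 :+ k) :* Z :+ (con 1 :+ k) :* Y) :+ (((con 1 :+ k) :* Y :+ k :* X) :+ Y :+ X))
         ≡.refl k X Y Z ⟩
  (suc (suc k) ℕ.* Z ℕ.+ suc k ℕ.* Y) ℕ.+ ((suc k ℕ.* Y ℕ.+ k ℕ.* X) ℕ.+ Y ℕ.+ X)
    ≡⟨ ≡.cong₂ (λ u v → u ℕ.+ (v ℕ.+ Y ℕ.+ X)) ([1+k]*nC[1+k]+k*nCk≡n*nCk n (suc k)) ([1+k]*nC[1+k]+k*nCk≡n*nCk n k) ⟩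
  n ℕ.* Y ℕ.+ (n ℕ.* X ℕ.+ Y ℕ.+ X)
    ≡⟨ solve 3 (λ n X Y → n :* Y :+ (n :* X :+ Y :+ X) := (con 1 :+ n) :* (X :+ Y)) ≡.refl n X Y ⟩
  suc n ℕ.* (X ℕ.+ Y)
    ≡⟨ ≡.cong (suc n ℕ.*_) (pascal k) ⟨
  suc n ℕ.* (suc n C suc k) ∎
  where
  open ≡.≡-Reasoning
  open import Data.Nat.Solver using (module +-*-Solver)
  open +-*-Solver
  pascal : ∀ k → suc n C suc k ≡.≡ n C k ℕ.+ n C suc k
  pascal k = ≡.sym (nCk+nC[k+1]≡[n+1]C[k+1] n k)
  X Y Z : ℕ
  X = n C k
  Y = n C suc k
  Z = n C suc (suc k)

module _ {ℓ ℓ₁ ℓ₂} (K : OrderedField ℓ ℓ₁ ℓ₂) where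
  open OrderedField K hiding (zero)
  open OF K
  open IntegerCoefficients commutativeRing
  open RingProperties ring using (-‿distribˡ-*; -1*x≈-x; -‿involutive; -‿+-comm)
  open CommutativeSemigroupProperties +-commutativeSemigroup using () renaming (interchange to +-interchange)
  open CommutativeSemigroupProperties *-commutativeSemigroup using (x∙yz≈y∙xz) renaming (interchange to *-interchange)
  open IsStrictTotalOrder isStrictTotalOrder using (compare; irrefl; <-respˡ-≈; <-respʳ-≈) renaming (trans to <-trans)
  open import Relation.Binary.Reasoning.Setoid setoid

  -- Arithmetic in an ordered field

  ι-homo-+ : ∀ m n → ι (m ℕ.+ n) ≈ ι m + ι n
  ι-homo-+ zero    n = sym (+-identityˡ (ι n))
  ι-homo-+ (suc m) n = trans (+-congˡ (ι-homo-+ m n)) (sym (+-assoc 1# (ι m) (ι n)))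

  ι-homo-* : ∀ m n → ι (m ℕ.* n) ≈ ι m * ι n
  ι-homo-* zero    n = sym (zeroˡ (ι n))
  ι-homo-* (suc m) n = begin
    ι (n ℕ.+ m ℕ.* n)      ≈⟨ ι-homo-+ n (m ℕ.* n) ⟩
    ι n + ι (m ℕ.* n)      ≈⟨ +-congˡ (ι-homo-* m n) ⟩
    ι n + ι m * ι n        ≈⟨ solve 2 (λ n m → n :+ m :* n := (con (+ 1) :+ m) :* n) refl (ι n) (ι m) ⟩
    (1# + ι m) * ι n       ∎

  0<1 : 0# < 1#
  0<1 with compare 0# 1#
  ... | tri< 0<1 _ _ = 0<1
  ... | tri≈ _ 0≈1 _ = contradiction 0≈1 0≉1
  ... | tri> _ _ 1<0 = contradiction (<-trans 1<0 (<-respʳ-≈ -1*-1≈1 (*-pos 0<-1 0<-1))) (irrefl refl)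
    where
    0<-1 : 0# < - 1#
    0<-1 = <-respʳ-≈ (+-identityˡ (- 1#)) (<-respˡ-≈ (-‿inverseʳ 1#) (+-mono-< (- 1#) 1<0))
    -1*-1≈1 : - 1# * - 1# ≈ 1#
    -1*-1≈1 = trans (-1*x≈-x (- 1#)) (-‿involutive 1#)

  0<ι[1+n] : ∀ n → 0# < ι (suc n)
  0<ι[1+n] zero    = <-respʳ-≈ (sym (+-identityʳ 1#)) 0<1
  0<ι[1+n] (suc n) = <-trans 0<1 (<-respʳ-≈ (+-comm (ι (suc n)) 1#)
                       (<-respˡ-≈ (+-identityˡ 1#) (+-mono-< 1# (0<ι[1+n] n))))

  >0⇒≉0 : ∀ {x} → 0# < x → ¬ x ≈ 0#
  >0⇒≉0 0<x x≈0 = irrefl (sym x≈0) 0<x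

  ι[n!]≉0 : ∀ n → ¬ ι (n ℕ.!) ≈ 0#
  ι[n!]≉0 n with n ℕ.! | ℕ.1≤n! n
  ... | suc m | _ = >0⇒≉0 (0<ι[1+n] m)

  x*[y/x]≈y : ∀ {x} y → ¬ x ≈ 0# → x * (y / x) ≈ y
  x*[y/x]≈y {x} y x≉0 = begin
    x * (y * x ⁻¹)     ≈⟨ solve 3 (λ x y x′ → x :* (y :* x′) := y :* (x :* x′)) refl x y (x ⁻¹) ⟩
    y * (x * x ⁻¹)     ≈⟨ *-congˡ (⁻¹-inverse x x≉0) ⟩
    y * 1#             ≈⟨ *-identityʳ y ⟩
    y                  ∎

  ⁻¹-unique : ∀ {x y} → ¬ x ≈ 0# → x * y ≈ 1# → y ≈ x ⁻¹
  ⁻¹-unique {x} {y} x≉0 xy≈1 = begin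
    y                  ≈⟨ x*[y/x]≈y y x≉0 ⟨
    x * (y * x ⁻¹)     ≈⟨ solve 3 (λ x y x′ → x :* (y :* x′) := (x :* y) :* x′) refl x y (x ⁻¹) ⟩
    (x * y) * x ⁻¹     ≈⟨ *-congʳ xy≈1 ⟩
    1# * x ⁻¹          ≈⟨ *-identityˡ (x ⁻¹) ⟩
    x ⁻¹               ∎

  x*y≉0 : ∀ {x y} → ¬ x ≈ 0# → ¬ y ≈ 0# → ¬ x * y ≈ 0#
  x*y≉0 {x} {y} x≉0 y≉0 xy≈0 = x≉0 (begin
    x                  ≈⟨ x*[y/x]≈y x y≉0 ⟨
    y * (x * y ⁻¹)     ≈⟨ solve 3 (λ x y y′ → y :* (x :* y′) := (x :* y) :* y′) refl x y (y ⁻¹) ⟩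
    (x * y) * y ⁻¹     ≈⟨ *-congʳ xy≈0 ⟩
    0# * y ⁻¹          ≈⟨ zeroˡ (y ⁻¹) ⟩
    0#                 ∎)

  ⁻¹-homo-* : ∀ {x y} → ¬ x ≈ 0# → ¬ y ≈ 0# → (x * y) ⁻¹ ≈ x ⁻¹ * y ⁻¹
  ⁻¹-homo-* {x} {y} x≉0 y≉0 = sym (⁻¹-unique (x*y≉0 x≉0 y≉0) (begin
    (x * y) * (x ⁻¹ * y ⁻¹)   ≈⟨ *-interchange x y (x ⁻¹) (y ⁻¹) ⟩
    (x * x ⁻¹) * (y * y ⁻¹)   ≈⟨ *-cong (⁻¹-inverse x x≉0) (⁻¹-inverse y y≉0) ⟩
    1# * 1#                   ≈⟨ *-identityˡ 1# ⟩
    1#                        ∎))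

  1⁻¹≈1 : 1# ⁻¹ ≈ 1#
  1⁻¹≈1 = sym (⁻¹-unique (λ 1≈0 → 0≉1 (sym 1≈0)) (*-identityˡ 1#))

  ^-congˡ : ∀ {x y} n → x ≈ y → x ^ n ≈ y ^ n
  ^-congˡ zero    x≈y = refl
  ^-congˡ (suc n) x≈y = *-cong x≈y (^-congˡ n x≈y)

  ^-distrib-* : ∀ x y n → (x * y) ^ n ≈ x ^ n * y ^ n
  ^-distrib-* x y zero    = sym (*-identityˡ 1#)
  ^-distrib-* x y (suc n) = trans (*-congˡ (^-distrib-* x y n)) (*-interchange x y (x ^ n) (y ^ n))

  -- Finite sums

  sumTo-cong : ∀ n {f g : ℕ → Carrier} → (∀ j → j ℕ.≤ n → f j ≈ g j) → sumTo n f ≈ sumTo n g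
  sumTo-cong zero    f≈g = f≈g 0 z≤n
  sumTo-cong (suc n) f≈g = +-cong (sumTo-cong n (λ j j≤n → f≈g j (ℕ.m≤n⇒m≤1+n j≤n))) (f≈g (suc n) ℕ.≤-refl)

  sumTo-zero : ∀ n {f : ℕ → Carrier} → (∀ j → j ℕ.≤ n → f j ≈ 0#) → sumTo n f ≈ 0#
  sumTo-zero zero    f≈0 = f≈0 0 z≤n
  sumTo-zero (suc n) f≈0 = trans (+-cong (sumTo-zero n (λ j j≤n → f≈0 j (ℕ.m≤n⇒m≤1+n j≤n))) (f≈0 (suc n) ℕ.≤-refl))
                                 (+-identityˡ 0#)

  sumTo-+ : ∀ n (f g : ℕ → Carrier) → sumTo n (λ j → f j + g j) ≈ sumTo n f + sumTo n g
  sumTo-+ zero    f g = refl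
  sumTo-+ (suc n) f g = trans (+-congʳ (sumTo-+ n f g)) (+-interchange _ _ _ _)

  sumTo-*ˡ : ∀ n x (f : ℕ → Carrier) → sumTo n (λ j → x * f j) ≈ x * sumTo n f
  sumTo-*ˡ zero    x f = refl
  sumTo-*ˡ (suc n) x f = trans (+-congʳ (sumTo-*ˡ n x f)) (sym (distribˡ x _ _))

  sumTo-*ʳ : ∀ n x (f : ℕ → Carrier) → sumTo n (λ j → f j * x) ≈ sumTo n f * x
  sumTo-*ʳ zero    x f = refl
  sumTo-*ʳ (suc n) x f = trans (+-congʳ (sumTo-*ʳ n x f)) (sym (distribʳ x _ _))

  sumTo-neg : ∀ n (f : ℕ → Carrier) → - sumTo n f ≈ sumTo n (λ j → - f j)
  sumTo-neg zero    f = refl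
  sumTo-neg (suc n) f = trans (sym (-‿+-comm _ _)) (+-congʳ (sumTo-neg n f))

  sumTo-suc : ∀ n (f : ℕ → Carrier) → sumTo (suc n) f ≈ f 0 + sumTo n (λ j → f (suc j))
  sumTo-suc zero    f = refl
  sumTo-suc (suc n) f = trans (+-congʳ (sumTo-suc n f)) (+-assoc _ _ _)

  sumTo-comm : ∀ m n (f : ℕ → ℕ → Carrier) →
    sumTo m (λ k → sumTo n (λ i → f i k)) ≈ sumTo n (λ i → sumTo m (λ k → f i k))
  sumTo-comm zero    n f = refl
  sumTo-comm (suc m) n f = trans (+-congʳ (sumTo-comm m n f))
    (sym (sumTo-+ n (λ i → sumTo m (λ k → f i k)) (λ i → f i (suc m))))

  -- Binomial coefficients

  ι-pascal : ∀ n k → ι (suc n C suc k) ≈ ι (n C k) + ι (n C suc k)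
  ι-pascal n k = trans (reflexive (≡.cong ι (≡.sym (nCk+nC[k+1]≡[n+1]C[k+1] n k)))) (ι-homo-+ (n C k) (n C suc k))

  ι[nC[1+n]]≈0 : ∀ n → ι (n C suc n) ≈ 0#
  ι[nC[1+n]]≈0 n = reflexive (≡.cong ι (k>n⇒nCk≡0 (ℕ.n<1+n n)))

  ι-absorption : ∀ n k → ι (suc k) * ι (n C suc k) + ι k * ι (n C k) ≈ ι n * ι (n C k)
  ι-absorption n k = begin
    ι (suc k) * ι (n C suc k) + ι k * ι (n C k)          ≈⟨ +-cong (ι-homo-* (suc k) (n C suc k)) (ι-homo-* k (n C k)) ⟨
    ι (suc k ℕ.* (n C suc k)) + ι (k ℕ.* (n C k))        ≈⟨ ι-homo-+ (suc k ℕ.* (n C suc k)) (k ℕ.* (n C k)) ⟨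
    ι (suc k ℕ.* (n C suc k) ℕ.+ k ℕ.* (n C k))          ≡⟨ ≡.cong ι ([1+k]*nC[1+k]+k*nCk≡n*nCk n k) ⟩
    ι (n ℕ.* (n C k))                                    ≈⟨ ι-homo-* n (n C k) ⟩
    ι n * ι (n C k)                                      ∎

  binomial-theorem : ∀ n y → sumTo n (λ k → ι (n C k) * y ^ k) ≈ (1# + y) ^ n
  binomial-theorem zero    y = trans (*-identityʳ _) (+-identityʳ 1#)
  binomial-theorem (suc n) y = begin
    sumTo (suc n) (λ k → ι (suc n C k) * y ^ k)
      ≈⟨ sumTo-suc n _ ⟩
    t 0 + sumTo n (λ k → ι (suc n C suc k) * (y * y ^ k))
      ≈⟨ +-congˡ (sumTo-cong n (λ k _ → pascal-term k)) ⟩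
    t 0 + sumTo n (λ k → y * t k + t (suc k))
      ≈⟨ +-congˡ (trans (sumTo-+ n _ _) (+-congʳ (sumTo-*ˡ n y t))) ⟩
    t 0 + (y * S + sumTo n (λ k → t (suc k)))
      ≈⟨ solve 3 (λ a b c → a :+ (b :+ c) := (a :+ c) :+ b) refl (t 0) (y * S) _ ⟩
    (t 0 + sumTo n (λ k → t (suc k))) + y * S
      ≈⟨ +-congʳ (trans (sym (sumTo-suc n t))
                        (trans (+-congˡ (trans (*-congʳ (ι[nC[1+n]]≈0 n)) (zeroˡ _))) (+-identityʳ S))) ⟩
    S + y * S
      ≈⟨ solve 2 (λ y S → S :+ y :* S := (con (+ 1) :+ y) :* S) refl y S ⟩
    (1# + y) * S
      ≈⟨ *-congˡ (binomial-theorem n y) ⟩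
    (1# + y) ^ suc n ∎
    where
    t : ℕ → Carrier
    t k = ι (n C k) * y ^ k
    S : Carrier
    S = sumTo n t
    pascal-term : ∀ k → ι (suc n C suc k) * (y * y ^ k) ≈ y * t k + t (suc k)
    pascal-term k = trans (*-congʳ (ι-pascal n k))
      (solve 4 (λ A B y Y → (A :+ B) :* (y :* Y) := y :* (A :* Y) :+ B :* (y :* Y))
         refl (ι (n C k)) (ι (n C suc k)) y (y ^ k))

  binomShift-< : ∀ n {i k} y → k ℕ.< i → binomShift n i k y ≈ 0#
  binomShift-< n {i} {k} y k<i with i ℕ.≤ᵇ k | ℕ.≤ᵇ⇒≤ i k
  ... | true  | i≤k = contradiction (i≤k tt) (ℕ.<⇒≱ k<i)
  ... | false | _   = refl

  binomShift-+ : ∀ m i l y → binomShift (m ℕ.+ i) i (l ℕ.+ i) y ≈ ι (m C l) * y ^ l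
  binomShift-+ m i l y with i ℕ.≤ᵇ (l ℕ.+ i) | ℕ.≤⇒≤ᵇ (ℕ.m≤n+m i l)
  ... | true | _ rewrite ℕ.m+n∸n≡m m i | ℕ.m+n∸n≡m l i = refl

  binomShift-suc : ∀ n i k y → binomShift (suc n) (suc i) (suc k) y ≈ binomShift n i k y
  binomShift-suc n zero    k y = refl
  binomShift-suc n (suc i) k y with i ℕ.<ᵇ k
  ... | true  = refl
  ... | false = refl

  binomShift-generating : ∀ y q {i n} → i ℕ.≤ n →
    sumTo n (λ k → binomShift n i k y * q ^ k) ≈ q ^ i * (1# + y * q) ^ (n ∸ i)
  binomShift-generating y q {n = n} z≤n = begin
    sumTo n (λ k → ι (n C k) * y ^ k * q ^ k)
      ≈⟨ sumTo-cong n (λ k _ → trans (*-assoc _ _ _) (*-congˡ (sym (^-distrib-* y q k)))) ⟩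
    sumTo n (λ k → ι (n C k) * (y * q) ^ k)   ≈⟨ binomial-theorem n (y * q) ⟩
    (1# + y * q) ^ n                          ≈⟨ *-identityˡ _ ⟨
    1# * (1# + y * q) ^ n                     ∎
  binomShift-generating y q {suc i} {suc n} (s≤s i≤n) = begin
    sumTo (suc n) (λ k → binomShift (suc n) (suc i) k y * q ^ k)
      ≈⟨ sumTo-suc n _ ⟩
    binomShift (suc n) (suc i) 0 y * 1# + sumTo n (λ k → binomShift (suc n) (suc i) (suc k) y * (q * q ^ k))
      ≈⟨ +-cong (trans (*-congʳ (binomShift-< (suc n) {suc i} y (s≤s z≤n))) (zeroˡ 1#))
                (sumTo-cong n (λ k _ → trans (*-congʳ (binomShift-suc n i k y))
                   (solve 3 (λ b q Q → b :* (q :* Q) := q :* (b :* Q)) refl (binomShift n i k y) q (q ^ k)))) ⟩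
    0# + sumTo n (λ k → q * (binomShift n i k y * q ^ k))
      ≈⟨ trans (+-identityˡ _) (sumTo-*ˡ n q _) ⟩
    q * sumTo n (λ k → binomShift n i k y * q ^ k)
      ≈⟨ *-congˡ (binomShift-generating y q i≤n) ⟩
    q * (q ^ i * (1# + y * q) ^ (n ∸ i))
      ≈⟨ *-assoc _ _ _ ⟨
    q ^ suc i * (1# + y * q) ^ (suc n ∸ suc i) ∎

  u^n*[q/u]^i≈q^i*u^[n∸i] : ∀ {u} q → ¬ u ≈ 0# → ∀ {i n} → i ℕ.≤ n → u ^ n * (q / u) ^ i ≈ q ^ i * u ^ (n ∸ i)
  u^n*[q/u]^i≈q^i*u^[n∸i] {u} q u≉0 {n = n} z≤n = *-comm (u ^ n) 1#
  u^n*[q/u]^i≈q^i*u^[n∸i] {u} q u≉0 {suc i} {suc n} (s≤s i≤n) = begin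
    (u * u ^ n) * ((q / u) * (q / u) ^ i)   ≈⟨ *-interchange u (u ^ n) (q / u) ((q / u) ^ i) ⟩
    (u * (q / u)) * (u ^ n * (q / u) ^ i)   ≈⟨ *-cong (x*[y/x]≈y q u≉0) (u^n*[q/u]^i≈q^i*u^[n∸i] q u≉0 i≤n) ⟩
    q * (q ^ i * u ^ (n ∸ i))               ≈⟨ *-assoc _ _ _ ⟨
    q ^ suc i * u ^ (suc n ∸ suc i)         ∎

  falling-cong : ∀ k {x y} → x ≈ y → falling x k ≈ falling y k
  falling-cong zero    x≈y = refl
  falling-cong (suc k) x≈y = *-cong (falling-cong k x≈y) (+-congʳ x≈y)

  falling-suc : ∀ x k → falling x (suc k) ≈ x * falling (x - 1#) k
  falling-suc x zero    = solve 1 (λ x → con (+ 1) :* (x :- con (+ 0)) := x :* con (+ 1)) refl x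
  falling-suc x (suc k) = begin
    falling x (suc k) * (x - ι (suc k))           ≈⟨ *-congʳ (falling-suc x k) ⟩
    x * falling (x - 1#) k * (x - (1# + ι k))
      ≈⟨ solve 3 (λ x f i → x :* f :* (x :- (con (+ 1) :+ i)) := x :* (f :* ((x :- con (+ 1)) :- i)))
           refl x (falling (x - 1#) k) (ι k) ⟩
    x * (falling (x - 1#) k * ((x - 1#) - ι k))   ∎

  binomR-zero : ∀ x → binomR x 0 ≈ 1#
  binomR-zero x = trans (*-identityˡ _) (trans (⁻¹-cong (+-identityʳ 1#)) 1⁻¹≈1)

  binomR-suc : ∀ x k → ι (suc k) * binomR (x + ι (suc k)) (suc k) ≈ (x + ι (suc k)) * binomR (x + ι k) k
  binomR-suc x k = begin
    ι (suc k) * (falling (x + ι (suc k)) (suc k) * ι (suc k ℕ.* k ℕ.!) ⁻¹)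
      ≈⟨ *-congˡ (*-cong (trans (falling-suc _ k) (*-congˡ (falling-cong k x+[1+k]-1≈x+k)))
                         (trans (⁻¹-cong (ι-homo-* (suc k) (k ℕ.!))) (⁻¹-homo-* ι[1+k]≉0 (ι[n!]≉0 k)))) ⟩
    ι (suc k) * ((x + ι (suc k)) * falling (x + ι k) k * (ι (suc k) ⁻¹ * ι (k ℕ.!) ⁻¹))
      ≈⟨ solve 5 (λ s y f s′ g → s :* (y :* f :* (s′ :* g)) := y :* (f :* g) :* (s :* s′)) refl
           (ι (suc k)) (x + ι (suc k)) (falling (x + ι k) k) (ι (suc k) ⁻¹) (ι (k ℕ.!) ⁻¹) ⟩
    (x + ι (suc k)) * binomR (x + ι k) k * (ι (suc k) * ι (suc k) ⁻¹)
      ≈⟨ trans (*-congˡ (⁻¹-inverse _ ι[1+k]≉0)) (*-identityʳ _) ⟩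
    (x + ι (suc k)) * binomR (x + ι k) k ∎
    where
    ι[1+k]≉0 : ¬ ι (suc k) ≈ 0#
    ι[1+k]≉0 = >0⇒≉0 (0<ι[1+n] k)
    x+[1+k]-1≈x+k : x + ι (suc k) - 1# ≈ x + ι k
    x+[1+k]-1≈x+k = solve 2 (λ x i → x :+ (con (+ 1) :+ i) :- con (+ 1) := x :+ i) refl x (ι k)

  -- Forward differences

  Δ^ : ℕ → (ℕ → Carrier) → ℕ → Carrier
  Δ^ zero    f t = f t
  Δ^ (suc i) f t = Δ^ i f (suc t) - Δ^ i f t

  Δ^-const : ∀ i x t → Δ^ (suc i) (λ _ → x) t ≈ 0#
  Δ^-const zero    x t = -‿inverseʳ x
  Δ^-const (suc i) x t = trans (+-cong (Δ^-const i x (suc t)) (-‿cong (Δ^-const i x t)))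
                               (trans (+-identityˡ _) (RingProperties.-0#≈0# ring))

  Δ^-expansion : ∀ i f t → Δ^ i f t ≈ sumTo i (λ j → ι (i C j) * ((- 1#) ^ (i ∸ j) * f (t ℕ.+ j)))
  Δ^-expansion zero    f t = sym (begin
    ι 1 * (1# * f (t ℕ.+ 0))   ≈⟨ trans (*-congʳ (+-identityʳ 1#)) (trans (*-identityˡ _) (*-identityˡ _)) ⟩
    f (t ℕ.+ 0)                ≡⟨ ≡.cong f (ℕ.+-identityʳ t) ⟩
    f t                        ∎)
  Δ^-expansion (suc i) f t = sym (begin
    sumTo (suc i) (λ j → ι (suc i C j) * ((- 1#) ^ (suc i ∸ j) * f (t ℕ.+ j)))
      ≈⟨ sumTo-suc i _ ⟩
    e₀ + sumTo i (λ j → ι (suc i C suc j) * Q j)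
      ≈⟨ +-congˡ (sumTo-cong i (λ j _ → trans (*-congʳ (ι-pascal i j)) (distribʳ (Q j) _ _))) ⟩
    e₀ + sumTo i (λ j → ι (i C j) * Q j + ι (i C suc j) * Q j)
      ≈⟨ +-congˡ (sumTo-+ i _ _) ⟩
    e₀ + (sumTo i (λ j → ι (i C j) * Q j) + U)
      ≈⟨ +-congˡ (+-congʳ (sumTo-cong i (λ j _ → *-congˡ (*-congˡ (reflexive (≡.cong f (ℕ.+-suc t j))))))) ⟩
    e₀ + (S (suc t) + U)
      ≈⟨ solve 3 (λ a s u → a :+ (s :+ u) := s :+ (a :+ u)) refl e₀ (S (suc t)) U ⟩
    S (suc t) + (e₀ + U)
      ≈⟨ +-cong (sym (Δ^-expansion i f (suc t))) (sym (trans (-‿cong (Δ^-expansion i f t)) -S≈e₀+U)) ⟩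
    Δ^ i f (suc t) - Δ^ i f t ∎)
    where
    s : ℕ → Carrier
    s k = (- 1#) ^ k
    S : ℕ → Carrier
    S t′ = sumTo i (λ j → ι (i C j) * (s (i ∸ j) * f (t′ ℕ.+ j)))
    Q : ℕ → Carrier
    Q j = s (i ∸ j) * f (t ℕ.+ suc j)
    e₀ U : Carrier
    e₀ = ι 1 * (s (suc i) * f (t ℕ.+ 0))
    U = sumTo i (λ j → ι (i C suc j) * Q j)
    -S≈e₀+U : - S t ≈ e₀ + U
    -S≈e₀+U = begin
      - S t
        ≈⟨ sumTo-neg i _ ⟩
      sumTo i (λ j → - (ι (i C j) * (s (i ∸ j) * f (t ℕ.+ j))))
        ≈⟨ sumTo-cong i (λ j j≤i → trans
             (solve 3 (λ A σ F → :- (A :* (σ :* F)) := A :* ((:- con (+ 1)) :* σ :* F))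
                refl (ι (i C j)) (s (i ∸ j)) (f (t ℕ.+ j)))
             (*-congˡ (*-congʳ (reflexive (≡.cong s (≡.sym (ℕ.+-∸-assoc 1 j≤i))))))) ⟩
      sumTo i (λ j → ι (i C j) * (s (suc i ∸ j) * f (t ℕ.+ j)))
        ≈⟨ sym (trans (+-congˡ (trans (*-congʳ (ι[nC[1+n]]≈0 i)) (zeroˡ _))) (+-identityʳ _)) ⟩
      sumTo (suc i) (λ j → ι (i C j) * (s (suc i ∸ j) * f (t ℕ.+ j)))
        ≈⟨ sumTo-suc i _ ⟩
      e₀ + U ∎

  Δ^-linear-* : ∀ a b g i t →
    Δ^ (suc i) (λ s → (b + a * ι s) * g s) t
      ≈ (b + a * ι (suc i ℕ.+ t)) * Δ^ (suc i) g t + a * ι (suc i) * Δ^ i g t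
  Δ^-linear-* a b g zero    t =
    solve 5 (λ a b T G₁ G₀ → (b :+ a :* (con (+ 1) :+ T)) :* G₁ :- (b :+ a :* T) :* G₀
               := (b :+ a :* (con (+ 1) :+ T)) :* (G₁ :- G₀) :+ a :* (con (+ 1) :+ con (+ 0)) :* G₀)
      refl a b (ι t) (g (suc t)) (g t)
  Δ^-linear-* a b g (suc i) t = begin
    Δ^ (suc i) pg (suc t) - Δ^ (suc i) pg t
      ≈⟨ +-cong (Δ^-linear-* a b g i (suc t)) (-‿cong (Δ^-linear-* a b g i t)) ⟩
    (b + a * ι (suc i ℕ.+ suc t)) * Y₁ + a * ι (suc i) * Z₁
      - ((b + a * ι (suc i ℕ.+ t)) * (Z₁ - Z₀) + a * ι (suc i) * Z₀)
      ≈⟨ +-cong (+-congʳ (*-congʳ (+-congˡ (*-congˡ (ι-homo-+ (suc i) (suc t))))))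
                (-‿cong (+-congʳ (*-congʳ (+-congˡ (*-congˡ (ι-homo-+ (suc i) t)))))) ⟩
    (b + a * (ι (suc i) + ι (suc t))) * Y₁ + a * ι (suc i) * Z₁
      - ((b + a * (ι (suc i) + ι t)) * (Z₁ - Z₀) + a * ι (suc i) * Z₀)
      ≈⟨ solve 7 (λ a b I T Y₁ Z₁ Z₀ →
            (b :+ a :* ((con (+ 1) :+ I) :+ (con (+ 1) :+ T))) :* Y₁ :+ a :* (con (+ 1) :+ I) :* Z₁
              :- ((b :+ a :* ((con (+ 1) :+ I) :+ T)) :* (Z₁ :- Z₀) :+ a :* (con (+ 1) :+ I) :* Z₀)
            := (b :+ a :* ((con (+ 1) :+ (con (+ 1) :+ I)) :+ T)) :* (Y₁ :- (Z₁ :- Z₀))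
                 :+ a :* (con (+ 1) :+ (con (+ 1) :+ I)) :* (Z₁ :- Z₀))
           refl a b (ι i) (ι t) Y₁ Z₁ Z₀ ⟩
    (b + a * (ι (suc (suc i)) + ι t)) * (Y₁ - (Z₁ - Z₀)) + a * ι (suc (suc i)) * (Z₁ - Z₀)
      ≈⟨ +-congʳ (*-congʳ (+-congˡ (*-congˡ (ι-homo-+ (suc (suc i)) t)))) ⟨
    (b + a * ι (suc (suc i) ℕ.+ t)) * Δ^ (suc (suc i)) g t + a * ι (suc (suc i)) * Δ^ (suc i) g t ∎
    where
    pg : ℕ → Carrier
    pg s = (b + a * ι s) * g s
    Y₁ Z₁ Z₀ : Carrier
    Y₁ = Δ^ (suc i) g (suc t)
    Z₁ = Δ^ i g (suc t)
    Z₀ = Δ^ i g t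

  -- Triangular recurrences

  Recurrence : (α β T : ℕ → ℕ → Carrier) → Set ℓ₁
  Recurrence α β T = ∀ n k → T (suc n) k ≈ α (suc n) k * T n k + β (suc n) k * prev T n k

  recurrence-unique : ∀ {α β T T′} → Recurrence α β T → Recurrence α β T′ →
    (∀ k → T 0 k ≈ T′ 0 k) → ∀ n k → T n k ≈ T′ n k
  recurrence-unique {α} {β} {T} {T′} rec rec′ T≈T′ = go
    where
    go : ∀ n k → T n k ≈ T′ n k
    go zero    k = T≈T′ k
    go (suc n) k = begin
      T (suc n) k                                          ≈⟨ rec n k ⟩
      α (suc n) k * T n k + β (suc n) k * prev T n k       ≈⟨ +-cong (*-congˡ (go n k)) (*-congˡ (prev-go k)) ⟩
      α (suc n) k * T′ n k + β (suc n) k * prev T′ n k     ≈⟨ rec′ n k ⟨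
      T′ (suc n) k                                         ∎
      where
      prev-go : ∀ k → prev T n k ≈ prev T′ n k
      prev-go zero    = refl
      prev-go (suc k) = go n k

  sumTo-recurrence : ∀ {α β T} → TriangularRec α β T → ∀ n (w : ℕ → Carrier) →
    sumTo (suc n) (λ i → T (suc n) i * w i)
      ≈ sumTo n (λ i → T n i * (α (suc n) i * w i + β (suc n) (suc i) * w (suc i)))
  sumTo-recurrence {α} {β} {T} tri n w = begin
    sumTo (suc n) (λ i → T (suc n) i * w i)
      ≈⟨ sumTo-cong (suc n) (λ i _ → trans (*-congʳ (rec n i))
           (solve 5 (λ a b t p w → (a :* t :+ b :* p) :* w := t :* (a :* w) :+ p :* (b :* w)) refl
              (α (suc n) i) (β (suc n) i) (T n i) (prev T n i) (w i))) ⟩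
    sumTo (suc n) (λ i → u i + v i)                      ≈⟨ sumTo-+ (suc n) u v ⟩
    sumTo n u + u (suc n) + sumTo (suc n) v
      ≈⟨ +-cong (trans (+-congˡ (trans (*-congʳ (zeros n (suc n) (ℕ.n<1+n n))) (zeroˡ _))) (+-identityʳ _))
                (trans (sumTo-suc n v) (trans (+-congʳ (zeroˡ _)) (+-identityˡ _))) ⟩
    sumTo n u + sumTo n (λ i → v (suc i))                ≈⟨ sumTo-+ n u (λ i → v (suc i)) ⟨
    sumTo n (λ i → u i + v (suc i))                      ≈⟨ sumTo-cong n (λ i _ → distribˡ (T n i) _ _) ⟨
    sumTo n (λ i → T n i * (α (suc n) i * w i + β (suc n) (suc i) * w (suc i))) ∎
    where
    open TriangularRec tri
    u v : ℕ → Carrier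
    u i = T n i * (α (suc n) i * w i)
    v i = prev T n i * (β (suc n) i * w i)

  module Arrays (a₁ a₂ b₁ b₂ : Carrier) (0<a₁ : 0# < a₁) (0<b₁ : 0# < b₁) where

    αF′ βF′ αD′ βD′ D′ : ℕ → ℕ → Carrier
    αF′ = αF a₁ a₂ b₁ b₂
    βF′ = βF a₁ a₂ b₁ b₂
    αD′ = αD a₁ a₂ b₁ b₂
    βD′ = βD a₁ a₂ b₁ b₂
    D′  = D a₁ a₂ b₁ b₂

    c x : Carrier
    c = b₁ / a₁
    x = - c

    a₁*x≈-b₁ : a₁ * x ≈ - b₁
    a₁*x≈-b₁ = trans (sym (RingProperties.-‿distribʳ-* ring a₁ c)) (-‿cong (x*[y/x]≈y b₁ (>0⇒≉0 0<a₁)))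

    -- The summand βF′ (suc n) zero * 0# makes the recurrence hold by refl.
    F : ℕ → ℕ → Carrier
    F zero    zero    = 1#
    F zero    (suc k) = 0#
    F (suc n) zero    = αF′ (suc n) zero * F n zero + βF′ (suc n) zero * 0#
    F (suc n) (suc k) = αF′ (suc n) (suc k) * F n (suc k) + βF′ (suc n) (suc k) * F n k

    F-triangular : TriangularRec αF′ βF′ F
    F-triangular = record { init = refl ; zeros = F-zeros ; rec = F-rec }
      where
      F-zeros : ∀ n k → n ℕ.< k → F n k ≈ 0#
      F-zeros zero    (suc k) _         = refl
      F-zeros (suc n) (suc k) (s≤s n<k) =
        trans (+-cong (*-congˡ (F-zeros n (suc k) (ℕ.m≤n⇒m≤1+n n<k))) (*-congˡ (F-zeros n k n<k)))
              (trans (+-cong (zeroʳ _) (zeroʳ _)) (+-identityʳ 0#))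
      F-rec : Recurrence αF′ βF′ F
      F-rec n zero    = refl
      F-rec n (suc k) = refl

    bs : ℕ → ℕ → ℕ → Carrier
    bs n i k = binomShift n i k x

    bs-prev : ℕ → ℕ → ℕ → Carrier
    bs-prev n i zero    = 0#
    bs-prev n i (suc k) = bs n i k

    bs-prev-≤ : ∀ n {i} k → k ℕ.≤ i → bs-prev n i k ≈ 0#
    bs-prev-≤ n zero    _   = refl
    bs-prev-≤ n (suc k) k<i = binomShift-< n x k<i

    Intertwines : ℕ → ℕ → ℕ → Set ℓ₁
    Intertwines n i k =
      αF′ (suc n) i * bs (suc n) i k + βF′ (suc n) (suc i) * bs (suc n) (suc i) k
        ≈ αD′ (suc n) k * bs n i k + βD′ (suc n) k * bs-prev n i k

    intertwines-< : ∀ {n i k} → k ℕ.< i → Intertwines n i k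
    intertwines-< {n} {i} {k} k<i = begin
      αF′ (suc n) i * bs (suc n) i k + βF′ (suc n) (suc i) * bs (suc n) (suc i) k
        ≈⟨ +-cong (*-congˡ (binomShift-< (suc n) x k<i)) (*-congˡ (binomShift-< (suc n) x (ℕ.m<n⇒m<1+n k<i))) ⟩
      αF′ (suc n) i * 0# + βF′ (suc n) (suc i) * 0#
        ≈⟨ solve 4 (λ a b a′ b′ → a :* con (+ 0) :+ b :* con (+ 0) := a′ :* con (+ 0) :+ b′ :* con (+ 0))
             refl (αF′ (suc n) i) (βF′ (suc n) (suc i)) (αD′ (suc n) k) (βD′ (suc n) k) ⟩
      αD′ (suc n) k * 0# + βD′ (suc n) k * 0#
        ≈⟨ +-cong (*-congˡ (binomShift-< n x k<i)) (*-congˡ (bs-prev-≤ n k (ℕ.<⇒≤ k<i))) ⟨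
      αD′ (suc n) k * bs n i k + βD′ (suc n) k * bs-prev n i k ∎

    αx+βF≈b₂ : ∀ n i → (a₁ * ι i + a₂) * x + βF′ n (suc i) ≈ b₂
    αx+βF≈b₂ n i = begin
      (a₁ * ι i + a₂) * x + βF′ n (suc i)
        ≈⟨ solve 6 (λ a₁ a₂ b₁ b₂ a₁′ I →
             (a₁ :* I :+ a₂) :* (:- (b₁ :* a₁′)) :+ (b₁ :* (con (+ 1) :+ I) :+ b₂ :- b₁ :+ (a₂ :* a₁′) :* b₁)
             := I :* (a₁ :* (:- (b₁ :* a₁′)) :+ b₁) :+ b₂)
           refl a₁ a₂ b₁ b₂ (a₁ ⁻¹) (ι i) ⟩
      ι i * (a₁ * x + b₁) + b₂
        ≈⟨ +-congʳ (*-congˡ (trans (+-congʳ a₁*x≈-b₁) (-‿inverseˡ b₁))) ⟩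
      ι i * 0# + b₂
        ≈⟨ trans (+-congʳ (zeroʳ (ι i))) (+-identityˡ b₂) ⟩
      b₂ ∎

    absorption-defect≈0 : ∀ m l →
      a₁ * x * (ι (suc l) * ι (m C suc l)) + b₁ * (ι m * ι (m C l) - ι l * ι (m C l)) ≈ 0#
    absorption-defect≈0 m l = begin
      a₁ * x * (ι (suc l) * B) + b₁ * (ι m * A - ι l * A)     ≈⟨ +-congʳ (*-congʳ a₁*x≈-b₁) ⟩
      - b₁ * (ι (suc l) * B) + b₁ * (ι m * A - ι l * A)
        ≈⟨ solve 5 (λ b L M A B → :- b :* ((con (+ 1) :+ L) :* B) :+ b :* (M :* A :- L :* A)
                                  := b :* (M :* A :- ((con (+ 1) :+ L) :* B :+ L :* A)))
             refl b₁ (ι l) (ι m) A B ⟩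
      b₁ * (ι m * A - (ι (suc l) * B + ι l * A))              ≈⟨ *-congˡ (+-congˡ (-‿cong (ι-absorption m l))) ⟩
      b₁ * (ι m * A - ι m * A)                                ≈⟨ trans (*-congˡ (-‿inverseʳ _)) (zeroʳ b₁) ⟩
      0#                                                      ∎
      where
      A B : Carrier
      A = ι (m C l)
      B = ι (m C suc l)

    -- The two sides differ by X times the vanishing absorption defect.
    pascal-step-identity : ∀ n i m l X → let A = ι (m C l); B = ι (m C suc l) in
      (a₁ * ι i + a₂) * ((A + B) * (x * X)) + βF′ n (suc i) * (A * X)
        ≈ (a₁ * (1# + (ι l + ι i)) + a₂) * (B * (x * X))
          + (b₁ * (1# + (ι m + ι i)) - b₁ * (1# + (ι l + ι i)) + b₂) * (A * X)
    pascal-step-identity n i m l X = begin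
      αᵢ * ((A + B) * (x * X)) + βF′ n (suc i) * (A * X)
        ≈⟨ solve 6 (λ α β A B x X → α :* ((A :+ B) :* (x :* X)) :+ β :* (A :* X)
                                     := α :* (B :* (x :* X)) :+ (α :* x :+ β) :* (A :* X))
             refl αᵢ (βF′ n (suc i)) A B x X ⟩
      αᵢ * (B * (x * X)) + (αᵢ * x + βF′ n (suc i)) * (A * X)
        ≈⟨ +-congˡ (*-congʳ (αx+βF≈b₂ n i)) ⟩
      αᵢ * (B * (x * X)) + b₂ * (A * X)
        ≈⟨ trans (+-congˡ (trans (*-congˡ (absorption-defect≈0 m l)) (zeroʳ X))) (+-identityʳ _) ⟨
      αᵢ * (B * (x * X)) + b₂ * (A * X) + X * (a₁ * x * (ι (suc l) * B) + b₁ * (ι m * A - ι l * A))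
        ≈⟨ solve 11 (λ a₁ a₂ b₁ b₂ I L M A B x X →
             (a₁ :* I :+ a₂) :* (B :* (x :* X)) :+ b₂ :* (A :* X)
               :+ X :* (a₁ :* x :* ((con (+ 1) :+ L) :* B) :+ b₁ :* (M :* A :- L :* A))
             := (a₁ :* (con (+ 1) :+ (L :+ I)) :+ a₂) :* (B :* (x :* X))
                  :+ (b₁ :* (con (+ 1) :+ (M :+ I)) :- b₁ :* (con (+ 1) :+ (L :+ I)) :+ b₂) :* (A :* X))
             refl a₁ a₂ b₁ b₂ (ι i) (ι l) (ι m) A B x X ⟩
      (a₁ * (1# + (ι l + ι i)) + a₂) * (B * (x * X))
        + (b₁ * (1# + (ι m + ι i)) - b₁ * (1# + (ι l + ι i)) + b₂) * (A * X) ∎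
      where
      αᵢ A B : Carrier
      αᵢ = a₁ * ι i + a₂
      A = ι (m C l)
      B = ι (m C suc l)

    -- Indices are written m + i and l + i so that suc m + i and suc l + i reduce.
    intertwines-+ : ∀ m i l → Intertwines (m ℕ.+ i) i (l ℕ.+ i)
    intertwines-+ m i zero = begin
      αᵢ * bs (suc m ℕ.+ i) i i + βF′ (suc (m ℕ.+ i)) (suc i) * bs (suc (m ℕ.+ i)) (suc i) i
        ≈⟨ +-cong (*-congˡ (binomShift-+ (suc m) i 0 x)) (*-congˡ (binomShift-< (suc (m ℕ.+ i)) x (ℕ.n<1+n i))) ⟩
      αᵢ * (ι 1 * 1#) + βF′ (suc (m ℕ.+ i)) (suc i) * 0#
        ≈⟨ +-congˡ (trans (zeroʳ _) (sym (zeroʳ _))) ⟩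
      αᵢ * (ι 1 * 1#) + βD′ (suc (m ℕ.+ i)) i * 0#
        ≈⟨ +-cong (*-congˡ (binomShift-+ m i 0 x)) (*-congˡ (bs-prev-≤ (m ℕ.+ i) i ℕ.≤-refl)) ⟨
      αD′ (suc (m ℕ.+ i)) i * bs (m ℕ.+ i) i i + βD′ (suc (m ℕ.+ i)) i * bs-prev (m ℕ.+ i) i i ∎
      where
      αᵢ = a₁ * ι i + a₂
    intertwines-+ m i (suc l) = begin
      αᵢ * bs (suc m ℕ.+ i) i (suc l ℕ.+ i) + βF′ (suc (m ℕ.+ i)) (suc i) * bs (suc (m ℕ.+ i)) (suc i) (suc (l ℕ.+ i))
        ≈⟨ +-cong (*-congˡ (trans (binomShift-+ (suc m) i (suc l) x) (*-congʳ (ι-pascal m l))))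
                  (*-congˡ (trans (binomShift-suc (m ℕ.+ i) i (l ℕ.+ i) x) (binomShift-+ m i l x))) ⟩
      αᵢ * ((A + B) * (x * X)) + βF′ (suc (m ℕ.+ i)) (suc i) * (A * X)
        ≈⟨ pascal-step-identity (suc (m ℕ.+ i)) i m l X ⟩
      (a₁ * (1# + (ι l + ι i)) + a₂) * (B * (x * X))
        + (b₁ * (1# + (ι m + ι i)) - b₁ * (1# + (ι l + ι i)) + b₂) * (A * X)
        ≈⟨ +-cong (*-cong (+-congʳ (*-congˡ (+-congˡ (ι-homo-+ l i)))) (binomShift-+ m i (suc l) x))
                  (*-cong (+-congʳ (+-cong (*-congˡ (+-congˡ (ι-homo-+ m i))) (-‿cong (*-congˡ (+-congˡ (ι-homo-+ l i))))))
                          (binomShift-+ m i l x)) ⟨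
      αD′ (suc (m ℕ.+ i)) (suc l ℕ.+ i) * bs (m ℕ.+ i) i (suc l ℕ.+ i)
        + βD′ (suc (m ℕ.+ i)) (suc l ℕ.+ i) * bs-prev (m ℕ.+ i) i (suc l ℕ.+ i) ∎
      where
      αᵢ A B X : Carrier
      αᵢ = a₁ * ι i + a₂
      A = ι (m C l)
      B = ι (m C suc l)
      X = x ^ l

    binomShift-intertwines : ∀ {n i} k → i ℕ.≤ n → Intertwines n i k
    binomShift-intertwines {n} {i} k i≤n with k ℕ.<? i
    ... | yes k<i = intertwines-< k<i
    ... | no  k≮i = ≡.subst₂ (λ n′ k′ → Intertwines n′ i k′) (ℕ.m∸n+n≡m i≤n) (ℕ.m∸n+n≡m (ℕ.≮⇒≥ k≮i))
                      (intertwines-+ (n ∸ i) i (k ∸ i))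

    E : ℕ → ℕ → Carrier
    E n k = sumTo n (λ i → F n i * bs n i k)

    D-recurrence : Recurrence αD′ βD′ D′
    D-recurrence n zero    = sym (trans (+-congˡ (zeroʳ _)) (+-identityʳ _))
    D-recurrence n (suc k) = refl

    E-recurrence : Recurrence αD′ βD′ E
    E-recurrence n k = begin
      E (suc n) k
        ≈⟨ sumTo-recurrence F-triangular n (λ i → bs (suc n) i k) ⟩
      sumTo n (λ i → F n i * (αF′ (suc n) i * bs (suc n) i k + βF′ (suc n) (suc i) * bs (suc n) (suc i) k))
        ≈⟨ sumTo-cong n (λ i i≤n → *-congˡ (binomShift-intertwines k i≤n)) ⟩
      sumTo n (λ i → F n i * (α * bs n i k + β * bs-prev n i k))
        ≈⟨ sumTo-cong n (λ i _ → distribˡ (F n i) _ _) ⟩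
      sumTo n (λ i → F n i * (α * bs n i k) + F n i * (β * bs-prev n i k))
        ≈⟨ sumTo-+ n _ _ ⟩
      sumTo n (λ i → F n i * (α * bs n i k)) + sumTo n (λ i → F n i * (β * bs-prev n i k))
        ≈⟨ +-cong (trans (sumTo-cong n (λ i _ → x∙yz≈y∙xz (F n i) α _)) (sumTo-*ˡ n α _))
                  (trans (sumTo-cong n (λ i _ → x∙yz≈y∙xz (F n i) β _)) (sumTo-*ˡ n β _)) ⟩
      α * E n k + β * sumTo n (λ i → F n i * bs-prev n i k)
        ≈⟨ +-congˡ (*-congˡ (Σbs-prev≈prev k)) ⟩
      α * E n k + β * prev E n k ∎
      where
      α β : Carrier
      α = αD′ (suc n) k
      β = βD′ (suc n) k
      Σbs-prev≈prev : ∀ k → sumTo n (λ i → F n i * bs-prev n i k) ≈ prev E n k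
      Σbs-prev≈prev zero    = sumTo-zero n (λ i _ → zeroʳ (F n i))
      Σbs-prev≈prev (suc k) = refl

    D≈E : ∀ n k → D′ n k ≈ E n k
    D≈E = recurrence-unique {αD′} {βD′} D-recurrence E-recurrence E₀
      where
      E₀ : ∀ k → D′ 0 k ≈ E 0 k
      E₀ zero    = sym (trans (*-identityˡ _) (trans (*-identityʳ _) (+-identityʳ 1#)))
      E₀ (suc k) = sym (trans (*-identityˡ _) (zeroˡ _))

    generating-function : ∀ n q → ¬ (1# - c * q ≈ 0#) →
      Dpoly a₁ a₂ b₁ b₂ n q ≈ (1# - c * q) ^ n * poly F n (q / (1# - c * q))
    generating-function n q u≉0 = begin
      sumTo n (λ k → D′ n k * q ^ k)
        ≈⟨ sumTo-cong n (λ k _ → trans (*-congʳ (D≈E n k))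
             (trans (sym (sumTo-*ʳ n (q ^ k) _)) (sumTo-cong n (λ i _ → *-assoc (F n i) (bs n i k) (q ^ k))))) ⟩
      sumTo n (λ k → sumTo n (λ i → F n i * (bs n i k * q ^ k)))
        ≈⟨ sumTo-comm n n _ ⟩
      sumTo n (λ i → sumTo n (λ k → F n i * (bs n i k * q ^ k)))
        ≈⟨ sumTo-cong n (λ i _ → sumTo-*ˡ n (F n i) _) ⟩
      sumTo n (λ i → F n i * sumTo n (λ k → bs n i k * q ^ k))
        ≈⟨ sumTo-cong n (λ i i≤n → *-congˡ (trans (binomShift-generating x q i≤n)
                                                  (*-congˡ (^-congˡ (n ∸ i) 1+xq≈u)))) ⟩
      sumTo n (λ i → F n i * (q ^ i * u ^ (n ∸ i)))
        ≈⟨ sumTo-cong n (λ i i≤n → trans (*-congˡ (sym (u^n*[q/u]^i≈q^i*u^[n∸i] q u≉0 i≤n)))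
                                         (x∙yz≈y∙xz _ _ _)) ⟩
      sumTo n (λ i → u ^ n * (F n i * (q / u) ^ i))
        ≈⟨ sumTo-*ˡ n (u ^ n) _ ⟩
      u ^ n * poly F n (q / u) ∎
      where
      u : Carrier
      u = 1# - c * q
      1+xq≈u : 1# + x * q ≈ u
      1+xq≈u = +-congˡ (sym (-‿distribˡ-* c q))

    r : Carrier
    r = a₂ / a₁ + b₂ / b₁ - 1#

    p : ℕ → Carrier
    p t = a₂ + a₁ * ι t

    G : ℕ → ℕ → Carrier
    G n i = binomR (r + ι i) i * c ^ i * Δ^ i (λ t → p t ^ n) 0

    βF≈[r+1+i]*b₁ : ∀ n i → βF′ n (suc i) ≈ (r + ι (suc i)) * b₁
    βF≈[r+1+i]*b₁ n i = sym (begin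
      (r + ι (suc i)) * b₁
        ≈⟨ solve 5 (λ A B′ b₁ b₂ I → (A :+ B′ :- con (+ 1) :+ (con (+ 1) :+ I)) :* b₁
                                      := b₁ :* (con (+ 1) :+ I) :+ b₁ :* B′ :- b₁ :+ A :* b₁)
             refl (a₂ / a₁) (b₂ / b₁) b₁ b₂ (ι i) ⟩
      b₁ * ι (suc i) + b₁ * (b₂ / b₁) - b₁ + (a₂ / a₁) * b₁
        ≈⟨ +-congʳ (+-congʳ (+-congˡ (x*[y/x]≈y b₂ (>0⇒≉0 0<b₁)))) ⟩
      βF′ n (suc i) ∎)

    G-recurrence : Recurrence αF′ βF′ G
    G-recurrence n zero = solve 5
      (λ a₁ a₂ B P β → B :* con (+ 1) :* ((a₂ :+ a₁ :* con (+ 0)) :* P)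
                       := (a₁ :* con (+ 0) :+ a₂) :* (B :* con (+ 1) :* P) :+ β :* con (+ 0))
      refl a₁ a₂ (binomR (r + 0#) 0) (p 0 ^ n) (βF′ (suc n) 0)
    G-recurrence n (suc i) = begin
      Bᵢ₊₁ * (c * cⁱ) * Δ^ (suc i) (λ t → p t * p t ^ n) 0
        ≈⟨ *-congˡ (Δ^-linear-* a₁ a₂ (λ t → p t ^ n) i 0) ⟩
      Bᵢ₊₁ * (c * cⁱ) * ((a₂ + a₁ * ι (suc i ℕ.+ 0)) * Y + a₁ * ι (suc i) * Z)
        ≡⟨ ≡.cong (λ j → Bᵢ₊₁ * (c * cⁱ) * ((a₂ + a₁ * ι j) * Y + a₁ * ι (suc i) * Z)) (ℕ.+-identityʳ (suc i)) ⟩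
      Bᵢ₊₁ * (c * cⁱ) * ((a₂ + a₁ * ι (suc i)) * Y + a₁ * ι (suc i) * Z)
        ≈⟨ solve 8 (λ a₁ a₂ I B c C Y Z → B :* (c :* C) :* ((a₂ :+ a₁ :* I) :* Y :+ a₁ :* I :* Z)
                                        := (a₁ :* I :+ a₂) :* (B :* (c :* C) :* Y) :+ (I :* B) :* (a₁ :* c) :* (C :* Z))
             refl a₁ a₂ (ι (suc i)) Bᵢ₊₁ c cⁱ Y Z ⟩
      αF′ (suc n) (suc i) * G n (suc i) + (ι (suc i) * Bᵢ₊₁) * (a₁ * c) * (cⁱ * Z)
        ≈⟨ +-congˡ (*-congʳ (*-cong (binomR-suc r i) (x*[y/x]≈y b₁ (>0⇒≉0 0<a₁)))) ⟩
      αF′ (suc n) (suc i) * G n (suc i) + ((r + ι (suc i)) * Bᵢ) * b₁ * (cⁱ * Z)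
        ≈⟨ +-congˡ (solve 5 (λ s B b C Z → s :* B :* b :* (C :* Z) := s :* b :* (B :* C :* Z))
                      refl (r + ι (suc i)) Bᵢ b₁ cⁱ Z) ⟩
      αF′ (suc n) (suc i) * G n (suc i) + ((r + ι (suc i)) * b₁) * G n i
        ≈⟨ +-congˡ (*-congʳ (βF≈[r+1+i]*b₁ (suc n) i)) ⟨
      αF′ (suc n) (suc i) * G n (suc i) + βF′ (suc n) (suc i) * G n i ∎
      where
      Bᵢ Bᵢ₊₁ cⁱ Y Z : Carrier
      Bᵢ   = binomR (r + ι i) i
      Bᵢ₊₁ = binomR (r + ι (suc i)) (suc i)
      cⁱ   = c ^ i
      Y    = Δ^ (suc i) (λ t → p t ^ n) 0
      Z    = Δ^ i (λ t → p t ^ n) 0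

    F≈G : ∀ n i → F n i ≈ G n i
    F≈G = recurrence-unique {αF′} {βF′} (TriangularRec.rec F-triangular) G-recurrence G₀
      where
      G₀ : ∀ i → F 0 i ≈ G 0 i
      G₀ zero    = sym (trans (*-identityʳ _) (trans (*-identityʳ _) (binomR-zero (r + 0#))))
      G₀ (suc i) = sym (trans (*-congˡ (Δ^-const i 1# 0)) (zeroʳ _))

    F-closed-form : ∀ n i → F n i ≈ sumTo i (λ j → binomR (r + ι i) i * ι (i C j) * c ^ i * (- 1#) ^ (i ∸ j) * p j ^ n)
    F-closed-form n i = begin
      F n i
        ≈⟨ F≈G n i ⟩
      binomR (r + ι i) i * c ^ i * Δ^ i (λ t → p t ^ n) 0
        ≈⟨ *-congˡ (Δ^-expansion i (λ t → p t ^ n) 0) ⟩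
      binomR (r + ι i) i * c ^ i * sumTo i (λ j → ι (i C j) * ((- 1#) ^ (i ∸ j) * p j ^ n))
        ≈⟨ sumTo-*ˡ i _ _ ⟨
      sumTo i (λ j → binomR (r + ι i) i * c ^ i * (ι (i C j) * ((- 1#) ^ (i ∸ j) * p j ^ n)))
        ≈⟨ sumTo-cong i (λ j _ → solve 5 (λ B C A s P → B :* C :* (A :* (s :* P)) := B :* A :* C :* s :* P)
                                    refl (binomR (r + ι i) i) (c ^ i) (ι (i C j)) ((- 1#) ^ (i ∸ j)) (p j ^ n)) ⟩
      sumTo i (λ j → binomR (r + ι i) i * ι (i C j) * c ^ i * (- 1#) ^ (i ∸ j) * p j ^ n) ∎

theorem3p2 : ∀ {c ℓ₁ ℓ₂} (K : OrderedField c ℓ₁ ℓ₂) →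
  let open OrderedField K
      open OF K in
  (a₁ a₂ b₁ b₂ : Carrier) → 0# < a₁ → 0# < b₁ → 0# ≤ a₂ → 0# ≤ b₂ →
  Σ (ℕ → ℕ → Carrier) λ F →
    TriangularRec (αF a₁ a₂ b₁ b₂) (βF a₁ a₂ b₁ b₂) F
    × (∀ n q → ¬ (1# - (b₁ / a₁) * q ≈ 0#) →
         Dpoly a₁ a₂ b₁ b₂ n q
           ≈ (1# - (b₁ / a₁) * q) ^ n * poly F n (q / (1# - (b₁ / a₁) * q)))
    × (∀ n k → D a₁ a₂ b₁ b₂ n k
         ≈ sumTo n (λ i → F n i * binomShift n i k (- (b₁ / a₁))))
    × (∀ n i → F n i
         ≈ sumTo i (λ j → binomR (a₂ / a₁ + b₂ / b₁ - 1# + ι i) i * ι (i C j)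
                           * (b₁ / a₁) ^ i * (- 1#) ^ (i ∸ j) * (a₂ + a₁ * ι j) ^ n))
theorem3p2 K a₁ a₂ b₁ b₂ 0<a₁ 0<b₁ _ _ =
  F , F-triangular , generating-function , D≈E , F-closed-form
  where open Arrays K a₁ a₂ b₁ b₂ 0<a₁ 0<b₁
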